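{- Let $\mathbf{A}=(A,\circ)$ be a linear quasigroup with arithmetic form $(A,+,\varphi_0,\varphi_1,0)$ (so $x\circ y=\varphi_0(x)+\varphi_1(y)$ with $(A,+)$ a group and $\varphi_0,\varphi_1\in\mathrm{Aut}(A,+)$), and assume $\varphi_0=\pi^a$ and $\varphi_1=\pi^b$ for some permutation $\pi$ of $A$ of order $m$ and some $a,b\in\mathbb{N}$. Let $t,t'\in B_n$ with corresponding binary trees $T,T'\in\mathcal{T}_n$. Then $\mathbf{A}$ satisfies $t\approx t'$ iff $T\equiv_{a,b\bmod m}T'$. Consequently $s_n(\mathbf{A})=|\mathcal{T}_n/{\equiv_{a,b\bmod m}}|$.
   Context: A bracketing of size $n$ is a fully parenthesised product of $x_1,\dots,x_n$ in this order; $B_n$ is their set. $\mathcal{T}_n$ is the set of binary trees with $n$ leaves (numbered $1,\dots,n$ left to right); bracketings correspond to trees via $\tau(x_i)=$ one-vertex tree, $\tau((t_1t_2))=$ tree whose root has left subtree $\tau(t_1)$ and right subtree $\tau(t_2)$. $\mathrm{ld}_T(i)$ and $\mathrm{rd}_T(i)$ are the numbers of left and right steps on the path from the root to leaf $i$. $T\equiv_{a,b\bmod m}T'$ iff $a\,\mathrm{ld}_T(i)+b\,\mathrm{rd}_T(i)\equiv a\,\mathrm{ld}_{T'}(i)+b\,\mathrm{rd}_{T'}(i)\pmod m$ for all $i$. $s_n(\mathbf{A})$ is the number of distinct term operations of $\mathbf{A}$ induced by bracketings of size $n$. -}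

module Defs where

open import Level using (Level; _⊔_)
open import Data.Nat using (ℕ; zero; suc; _+_; _*_; _<_; NonZero)
open import Data.Nat.DivMod using (_%_)
open import Data.Fin using (Fin; splitAt; _↑ˡ_; _↑ʳ_)
import Data.Fin as Fin
open import Data.Sum using (inj₁; inj₂)
open import Data.Vec using (Vec; lookup)
open import Data.Product using (Σ; ∃; _×_; _,_)
open import Relation.Binary.PropositionalEquality using (_≡_)
open import Relation.Nullary using (¬_)
open import Algebra.Bundles using (Group)

-- Bracketings of size n: fully parenthesised products of x_1,...,x_n (in order).
data Br : ℕ → Set where
  x  : Br 1
  _⊙_ : ∀ {k l} → Br k → Br l → Br (k + l)

-- Binary trees with n leaves (leaves numbered left to right by Fin n).
data Tree : ℕ → Set where
  leaf : Tree 1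
  node : ∀ {k l} → Tree k → Tree l → Tree (k + l)

τ : ∀ {n} → Br n → Tree n
τ x = leaf
τ (t₁ ⊙ t₂) = node (τ t₁) (τ t₂)

ld : ∀ {n} → Tree n → Fin n → ℕ
ld leaf _ = 0
ld (node {k} T₁ T₂) i with splitAt k i
... | inj₁ j = suc (ld T₁ j)
... | inj₂ j = ld T₂ j

rd : ∀ {n} → Tree n → Fin n → ℕ
rd leaf _ = 0
rd (node {k} T₁ T₂) i with splitAt k i
... | inj₁ j = rd T₁ j
... | inj₂ j = suc (rd T₂ j)

ModEqTree : (a b m : ℕ) .{{_ : NonZero m}} → ∀ {n} → Tree n → Tree n → Set
ModEqTree a b m {n} T T' =
  (i : Fin n) → (a * ld T i + b * rd T i) % m ≡ (a * ld T' i + b * rd T' i) % m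

_^[_] : ∀ {a} {A : Set a} → (A → A) → ℕ → A → A
(f ^[ zero ]) y = y
(f ^[ suc k ]) y = f ((f ^[ k ]) y)

-- The relation R on X has exactly k equivalence classes (R assumed an equivalence):
-- there are k pairwise inequivalent representatives, and every element is
-- equivalent to one of them.
HasClasses : ∀ {c ℓ} {X : Set c} → (X → X → Set ℓ) → ℕ → Set (c ⊔ ℓ)
HasClasses {X = X} R k =
  Σ (Vec X k) λ v →
    ((i j : Fin k) → R (lookup v i) (lookup v j) → i ≡ j)
    × ((y : X) → ∃ λ i → R y (lookup v i))

module _ {c ℓ} (G : Group c ℓ) where
  open Group G renaming (Carrier to A)

  IsPerm : (A → A) → Set (c ⊔ ℓ)
  IsPerm π = (∀ {y z} → y ≈ z → π y ≈ π z)
           × (∃ λ (ρ : A → A) → (∀ {y z} → y ≈ z → ρ y ≈ ρ z)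
                              × (∀ y → π (ρ y) ≈ y) × (∀ y → ρ (π y) ≈ y))

  IsAut : (A → A) → Set (c ⊔ ℓ)
  IsAut φ = IsPerm φ × (∀ y z → φ (y ∙ z) ≈ φ y ∙ φ z)

  HasOrder : (A → A) → ℕ → Set (c ⊔ ℓ)
  HasOrder π m = (0 < m) × (∀ y → (π ^[ m ]) y ≈ y)
               × (∀ k → 0 < k → k < m → ¬ (∀ y → (π ^[ k ]) y ≈ y))

  eval : (A → A) → (A → A) → ∀ {n} → Br n → (Fin n → A) → A
  eval φ₀ φ₁ x e = e Fin.zero
  eval φ₀ φ₁ (_⊙_ {k} {l} t₁ t₂) e =
    φ₀ (eval φ₀ φ₁ t₁ (λ i → e (i ↑ˡ l))) ∙ φ₁ (eval φ₀ φ₁ t₂ (λ i → e (k ↑ʳ i)))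

  Satisfies : (A → A) → (A → A) → ∀ {n} → Br n → Br n → Set (c ⊔ ℓ)
  Satisfies φ₀ φ₁ {n} t t' = (e : Fin n → A) → eval φ₀ φ₁ t e ≈ eval φ₀ φ₁ t' e

-- In the arithmetic form, the term operation of a bracketing t is the ordered sum over
-- the leaves i of π^(a·ld(i) + b·rd(i)) applied to x_i: a left step contributes φ₀ = π^a,
-- a right step φ₁ = π^b, and both distribute over the sum.  Putting y in one variable
-- and 0 in all others isolates a single leaf, so t ≈ t' holds iff π^w = π^w' for the
-- weights w, w' of every leaf, i.e. iff w ≡ w' (mod m) since π has order m.  Trees and
-- bracketings are in bijection, so the two equivalences have the same number of classes.
module Submission where

open import Defs
open import Data.Nat using (ℕ; zero; suc; _+_; _*_; _∸_; _≤_; _<_; _/_; NonZero; s≤s; z≤n)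
open import Data.Nat.DivMod using (_%_; m≡m%n+[m/n]*n; m%n<n)
open import Data.Nat.Properties using (*-suc; *-zeroʳ; *-comm; ≤-antisym; m∸n≡0⇒m≤n; m+[n∸m]≡n; m∸n≤m; ≤-<-trans; ≤-total)
open import Data.Nat.Tactic.RingSolver using (solve-∀)
open import Data.Empty using (⊥-elim)
open import Data.Product using (_×_; _,_; ∃; proj₁; proj₂)
open import Data.Sum using (inj₁; inj₂)
open import Data.Fin using (Fin; _↑ˡ_; _↑ʳ_)
import Data.Fin as Fin
open import Data.Fin.Properties using (splitAt-↑ˡ; splitAt-↑ʳ)
open import Data.Vec using (map; lookup)
open import Data.Vec.Properties using (lookup-map)
open import Data.Vec.Functional using (Vector; tail)
open import Function using (_∘_)
open import Function.Bundles using (_⇔_; mk⇔; Equivalence)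
open import Algebra.Bundles using (Group)
open import Relation.Binary.PropositionalEquality as ≡ using (_≡_; cong; subst; subst₂)
import Algebra.Properties.Group as GroupProperties
import Algebra.Properties.Monoid.Sum as MonoidSum
import Relation.Binary.Reasoning.Setoid as SetoidReasoning

^[]-+ : ∀ {a} {A : Set a} (f : A → A) p q y → (f ^[ p + q ]) y ≡ (f ^[ p ]) ((f ^[ q ]) y)
^[]-+ f zero    q y = ≡.refl
^[]-+ f (suc p) q y = cong f (^[]-+ f p q y)

bracketing : ∀ {n} → Tree n → Br n
bracketing leaf         = x
bracketing (node T₁ T₂) = bracketing T₁ ⊙ bracketing T₂

τ-bracketing : ∀ {n} (T : Tree n) → τ (bracketing T) ≡ T
τ-bracketing leaf         = ≡.refl
τ-bracketing (node T₁ T₂) = ≡.cong₂ node (τ-bracketing T₁) (τ-bracketing T₂)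

HasClasses-transport : ∀ {c d ℓ ℓ′} {X : Set c} {Y : Set d}
  (R : X → X → Set ℓ) (S : Y → Y → Set ℓ′) (f : X → Y) (g : Y → X) →
  (∀ y → f (g y) ≡ y) → (∀ z z′ → R z z′ ⇔ S (f z) (f z′)) →
  ∀ k → HasClasses R k ⇔ HasClasses S k
HasClasses-transport R S f g f∘g≡id R⇔S k = mk⇔ forth back
  where
  forth : HasClasses R k → HasClasses S k
  forth (v , distinct , covers) = map f v , distinct′ , covers′
    where
    distinct′ : ∀ i j → S (lookup (map f v) i) (lookup (map f v) j) → i ≡ j
    distinct′ i j s rewrite lookup-map i f v | lookup-map j f v =
      distinct i j (Equivalence.from (R⇔S _ _) s)
    covers′ : ∀ y → ∃ λ i → S y (lookup (map f v) i)
    covers′ y with covers (g y)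
    ... | i , r = i , subst₂ S (f∘g≡id y) (≡.sym (lookup-map i f v)) (Equivalence.to (R⇔S _ _) r)
  back : HasClasses S k → HasClasses R k
  back (v , distinct , covers) = map g v , distinct′ , covers′
    where
    distinct′ : ∀ i j → R (lookup (map g v) i) (lookup (map g v) j) → i ≡ j
    distinct′ i j r rewrite lookup-map i g v | lookup-map j g v =
      distinct i j (subst₂ S (f∘g≡id _) (f∘g≡id _) (Equivalence.to (R⇔S _ _) r))
    covers′ : ∀ z → ∃ λ i → R z (lookup (map g v) i)
    covers′ z with covers (f z)
    ... | i , s = i , subst (R z) (≡.sym (lookup-map i g v))
                        (Equivalence.from (R⇔S _ _) (subst (S (f z)) (≡.sym (f∘g≡id _)) s))

module _ {c ℓ} (G : Group c ℓ) where
  open Group G renaming (Carrier to A)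
  open GroupProperties G using (identityˡ-unique)
  open MonoidSum monoid using (sum; sum-cong-≋; sum-replicate-zero)

  sum-↑ : ∀ k {l} (f : Vector A (k + l)) →
          sum f ≈ sum (λ i → f (i ↑ˡ l)) ∙ sum (λ i → f (k ↑ʳ i))
  sum-↑ zero    f = sym (identityˡ _)
  sum-↑ (suc k) f = trans (∙-congˡ (sum-↑ k (tail f))) (sym (assoc _ _ _))

  aut-ε : ∀ {φ} → IsAut G φ → φ ε ≈ ε
  aut-ε {φ} ((φ-cong , _) , φ-∙) =
    identityˡ-unique (φ ε) (φ ε) (trans (sym (φ-∙ ε ε)) (φ-cong (identityˡ ε)))

  aut-sum : ∀ {φ} → IsAut G φ → ∀ {n} (f : Vector A n) → φ (sum f) ≈ sum (φ ∘ f)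
  aut-sum aut {zero}  f = aut-ε aut
  aut-sum aut {suc n} f = trans (proj₂ aut _ _) (∙-congˡ (aut-sum aut (tail f)))

  single : ∀ {n} → Fin n → A → Vector A n
  single Fin.zero    y Fin.zero    = y
  single Fin.zero    y (Fin.suc j) = ε
  single (Fin.suc i) y Fin.zero    = ε
  single (Fin.suc i) y (Fin.suc j) = single i y j

  sum-ε : ∀ {n} (g : Fin n → A → A) → (∀ j → g j ε ≈ ε) → sum (λ j → g j ε) ≈ ε
  sum-ε {n} g g-ε = trans (sum-cong-≋ g-ε) (sum-replicate-zero n)

  sum-single : ∀ {n} (g : Fin n → A → A) → (∀ j → g j ε ≈ ε) →
               ∀ i y → sum (λ j → g j (single i y j)) ≈ g i y
  sum-single g g-ε Fin.zero y =
    trans (∙-congˡ (sum-ε (g ∘ Fin.suc) (g-ε ∘ Fin.suc))) (identityʳ _)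
  sum-single g g-ε (Fin.suc i) y =
    trans (∙-cong (g-ε Fin.zero) (sum-single (g ∘ Fin.suc) (g-ε ∘ Fin.suc) i y)) (identityˡ _)

  IsPerm-injective : ∀ {π} → IsPerm G π → ∀ {y z} → π y ≈ π z → y ≈ z
  IsPerm-injective (_ , ρ , ρ-cong , _ , ρ∘π) {y} {z} πy≈πz =
    trans (sym (ρ∘π y)) (trans (ρ-cong πy≈πz) (ρ∘π z))

  module Powers (π : A → A) (perm : IsPerm G π) where

    ^-cong : ∀ k {y z} → y ≈ z → (π ^[ k ]) y ≈ (π ^[ k ]) z
    ^-cong zero    y≈z = y≈z
    ^-cong (suc k) y≈z = proj₁ perm (^-cong k y≈z)

    ^-injective : ∀ k {y z} → (π ^[ k ]) y ≈ (π ^[ k ]) z → y ≈ z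
    ^-injective zero    e = e
    ^-injective (suc k) e = ^-injective k (IsPerm-injective perm e)

    Fixes : ℕ → A → Set ℓ
    Fixes k y = (π ^[ k ]) y ≈ y

    Fixes-+ : ∀ u v {y} → Fixes u y → Fixes v y → Fixes (u + v) y
    Fixes-+ u v {y} fu fv = trans (reflexive (^[]-+ π u v y)) (trans (^-cong u fv) fu)

    Fixes-* : ∀ u {y} → Fixes u y → ∀ p → Fixes (u * p) y
    Fixes-* u {y} fu zero    = subst (λ k → Fixes k y) (≡.sym (*-zeroʳ u)) refl
    Fixes-* u {y} fu (suc p) =
      subst (λ k → Fixes k y) (≡.sym (*-suc u p)) (Fixes-+ u (u * p) fu (Fixes-* u fu p))

    module Order {m} .{{_ : NonZero m}} (order : HasOrder G π m) where

      open SetoidReasoning setoid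

      ^-mod : ∀ n y → (π ^[ n ]) y ≈ (π ^[ n % m ]) y
      ^-mod n y = begin
        (π ^[ n ]) y                                ≡⟨ cong (λ k → (π ^[ k ]) y) (m≡m%n+[m/n]*n n m) ⟩
        (π ^[ n % m + n / m * m ]) y                ≡⟨ ^[]-+ π (n % m) (n / m * m) y ⟩
        (π ^[ n % m ]) ((π ^[ n / m * m ]) y)       ≈⟨ ^-cong (n % m) whole-periods ⟩
        (π ^[ n % m ]) y                            ∎
        where
        whole-periods : Fixes (n / m * m) y
        whole-periods = subst (λ k → Fixes k y) (*-comm m (n / m))
                              (Fixes-* m (proj₁ (proj₂ order) y) (n / m))

      Fixes-all-below-order⇒≡0 : ∀ {d} → d < m → (∀ y → Fixes d y) → d ≡ 0
      Fixes-all-below-order⇒≡0 {zero}  _   _   = ≡.refl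
      Fixes-all-below-order⇒≡0 {suc d} d<m fix = ⊥-elim (proj₂ (proj₂ order) (suc d) (s≤s z≤n) d<m fix)

      ^-≈⇒≡-below-order : ∀ {r s} → s < m → r ≤ s →
                        (∀ y → (π ^[ r ]) y ≈ (π ^[ s ]) y) → r ≡ s
      ^-≈⇒≡-below-order {r} {s} s<m r≤s π^r≈π^s = ≤-antisym r≤s (m∸n≡0⇒m≤n d≡0)
        where
        d≡0 : s ∸ r ≡ 0
        d≡0 = Fixes-all-below-order⇒≡0 (≤-<-trans (m∸n≤m s r) s<m) λ y → sym (^-injective r (begin
          (π ^[ r ]) y                  ≈⟨ π^r≈π^s y ⟩
          (π ^[ s ]) y                  ≡⟨ cong (λ k → (π ^[ k ]) y) (≡.sym (m+[n∸m]≡n r≤s)) ⟩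
          (π ^[ r + (s ∸ r) ]) y        ≡⟨ ^[]-+ π r (s ∸ r) y ⟩
          (π ^[ r ]) ((π ^[ s ∸ r ]) y) ∎))

      ^-≈⇔%-≡ : ∀ u v → (∀ y → (π ^[ u ]) y ≈ (π ^[ v ]) y) ⇔ u % m ≡ v % m
      ^-≈⇔%-≡ u v = mk⇔ forth back
        where
        reduced : (∀ y → (π ^[ u ]) y ≈ (π ^[ v ]) y) → ∀ y → (π ^[ u % m ]) y ≈ (π ^[ v % m ]) y
        reduced e y = trans (sym (^-mod u y)) (trans (e y) (^-mod v y))
        forth : (∀ y → (π ^[ u ]) y ≈ (π ^[ v ]) y) → u % m ≡ v % m
        forth e with ≤-total (u % m) (v % m)
        ... | inj₁ u≤v = ^-≈⇒≡-below-order (m%n<n v m) u≤v (reduced e)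
        ... | inj₂ v≤u = ≡.sym (^-≈⇒≡-below-order (m%n<n u m) v≤u (sym ∘ reduced e))
        back : u % m ≡ v % m → ∀ y → (π ^[ u ]) y ≈ (π ^[ v ]) y
        back u≡v y = trans (^-mod u y) (trans (reflexive (cong (λ k → (π ^[ k ]) y) u≡v)) (sym (^-mod v y)))

  module LinearQuasigroup (φ₀ φ₁ π : A → A) (a b : ℕ)
    (aut₀ : IsAut G φ₀) (aut₁ : IsAut G φ₁) (perm : IsPerm G π)
    (φ₀≈π^a : ∀ y → φ₀ y ≈ (π ^[ a ]) y) (φ₁≈π^b : ∀ y → φ₁ y ≈ (π ^[ b ]) y) where

    open Powers π perm
    open SetoidReasoning setoid

    weight : ∀ {n} → Tree n → Fin n → ℕ
    weight T i = a * ld T i + b * rd T i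

    weight-↑ˡ : ∀ {k l} (T₁ : Tree k) (T₂ : Tree l) i → weight (node T₁ T₂) (i ↑ˡ l) ≡ a + weight T₁ i
    weight-↑ˡ {k} {l} T₁ T₂ i rewrite splitAt-↑ˡ k i l = arithmetic a b (ld T₁ i) (rd T₁ i)
      where
      arithmetic : ∀ a b p q → a * suc p + b * q ≡ a + (a * p + b * q)
      arithmetic = solve-∀

    weight-↑ʳ : ∀ {k l} (T₁ : Tree k) (T₂ : Tree l) i → weight (node T₁ T₂) (k ↑ʳ i) ≡ b + weight T₂ i
    weight-↑ʳ {k} {l} T₁ T₂ i rewrite splitAt-↑ʳ k l i = arithmetic a b (ld T₂ i) (rd T₂ i)
      where
      arithmetic : ∀ a b p q → a * p + b * suc q ≡ b + (a * p + b * q)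
      arithmetic = solve-∀

    φ₀-π^weight : ∀ {k l} (T₁ : Tree k) (T₂ : Tree l) i y →
                  φ₀ ((π ^[ weight T₁ i ]) y) ≈ (π ^[ weight (node T₁ T₂) (i ↑ˡ l) ]) y
    φ₀-π^weight T₁ T₂ i y = begin
      φ₀ ((π ^[ weight T₁ i ]) y)                 ≈⟨ φ₀≈π^a _ ⟩
      (π ^[ a ]) ((π ^[ weight T₁ i ]) y)         ≡⟨ ≡.sym (^[]-+ π a (weight T₁ i) y) ⟩
      (π ^[ a + weight T₁ i ]) y                  ≡⟨ cong (λ k → (π ^[ k ]) y) (≡.sym (weight-↑ˡ T₁ T₂ i)) ⟩
      (π ^[ weight (node T₁ T₂) (i ↑ˡ _) ]) y     ∎

    φ₁-π^weight : ∀ {k l} (T₁ : Tree k) (T₂ : Tree l) i y →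
                  φ₁ ((π ^[ weight T₂ i ]) y) ≈ (π ^[ weight (node T₁ T₂) (k ↑ʳ i) ]) y
    φ₁-π^weight T₁ T₂ i y = begin
      φ₁ ((π ^[ weight T₂ i ]) y)                 ≈⟨ φ₁≈π^b _ ⟩
      (π ^[ b ]) ((π ^[ weight T₂ i ]) y)         ≡⟨ ≡.sym (^[]-+ π b (weight T₂ i) y) ⟩
      (π ^[ b + weight T₂ i ]) y                  ≡⟨ cong (λ k → (π ^[ k ]) y) (≡.sym (weight-↑ʳ T₁ T₂ i)) ⟩
      (π ^[ weight (node T₁ T₂) (_ ↑ʳ i) ]) y     ∎

    eval-≈-sum : ∀ {n} (t : Br n) e → eval G φ₀ φ₁ t e ≈ sum (λ i → (π ^[ weight (τ t) i ]) (e i))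
    eval-≈-sum x e rewrite *-zeroʳ a | *-zeroʳ b = sym (identityʳ _)
    eval-≈-sum (_⊙_ {k} {l} t₁ t₂) e = begin
      φ₀ (eval G φ₀ φ₁ t₁ e₁) ∙ φ₁ (eval G φ₀ φ₁ t₂ e₂)
        ≈⟨ ∙-cong (proj₁ (proj₁ aut₀) (eval-≈-sum t₁ e₁)) (proj₁ (proj₁ aut₁) (eval-≈-sum t₂ e₂)) ⟩
      φ₀ (sum s₁) ∙ φ₁ (sum s₂)
        ≈⟨ ∙-cong (aut-sum aut₀ s₁) (aut-sum aut₁ s₂) ⟩
      sum (φ₀ ∘ s₁) ∙ sum (φ₁ ∘ s₂)
        ≈⟨ ∙-cong (sum-cong-≋ λ i → φ₀-π^weight T₁ T₂ i (e₁ i))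
                  (sum-cong-≋ λ i → φ₁-π^weight T₁ T₂ i (e₂ i)) ⟩
      sum (λ i → (π ^[ weight T (i ↑ˡ l) ]) (e₁ i)) ∙ sum (λ i → (π ^[ weight T (k ↑ʳ i) ]) (e₂ i))
        ≈⟨ sum-↑ k _ ⟨
      sum (λ i → (π ^[ weight T i ]) (e i)) ∎
      where
      T₁ : Tree k
      T₁ = τ t₁
      T₂ : Tree l
      T₂ = τ t₂
      T : Tree (k + l)
      T = node T₁ T₂
      e₁ : Vector A k
      e₁ i = e (i ↑ˡ l)
      e₂ : Vector A l
      e₂ i = e (k ↑ʳ i)
      s₁ : Vector A k
      s₁ i = (π ^[ weight T₁ i ]) (e₁ i)
      s₂ : Vector A l
      s₂ i = (π ^[ weight T₂ i ]) (e₂ i)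

    weight-Fixes-ε : ∀ {n} (T : Tree n) i → Fixes (weight T i) ε
    weight-Fixes-ε T i = Fixes-+ (a * ld T i) (b * rd T i)
      (Fixes-* a (trans (sym (φ₀≈π^a ε)) (aut-ε aut₀)) (ld T i))
      (Fixes-* b (trans (sym (φ₁≈π^b ε)) (aut-ε aut₁)) (rd T i))

    module _ {m} .{{_ : NonZero m}} (order : HasOrder G π m) where
      open Order order

      Satisfies⇔ModEqTree : ∀ {n} (t t′ : Br n) → Satisfies G φ₀ φ₁ t t′ ⇔ ModEqTree a b m (τ t) (τ t′)
      Satisfies⇔ModEqTree t t′ = mk⇔ forth back
        where
        forth : Satisfies G φ₀ φ₁ t t′ → ModEqTree a b m (τ t) (τ t′)
        forth t≈t′ i = Equivalence.to (^-≈⇔%-≡ _ _) λ y → begin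
          (π ^[ weight (τ t) i ]) y                            ≈⟨ sum-single _ (weight-Fixes-ε (τ t)) i y ⟨
          sum (λ j → (π ^[ weight (τ t) j ]) (single i y j))   ≈⟨ eval-≈-sum t _ ⟨
          eval G φ₀ φ₁ t (single i y)                          ≈⟨ t≈t′ _ ⟩
          eval G φ₀ φ₁ t′ (single i y)                         ≈⟨ eval-≈-sum t′ _ ⟩
          sum (λ j → (π ^[ weight (τ t′) j ]) (single i y j))  ≈⟨ sum-single _ (weight-Fixes-ε (τ t′)) i y ⟩
          (π ^[ weight (τ t′) i ]) y                           ∎
        back : ModEqTree a b m (τ t) (τ t′) → Satisfies G φ₀ φ₁ t t′
        back w≡w′ e = begin
          eval G φ₀ φ₁ t e                               ≈⟨ eval-≈-sum t e ⟩
          sum (λ i → (π ^[ weight (τ t) i ]) (e i))      ≈⟨ sum-cong-≋ (λ i → Equivalence.from (^-≈⇔%-≡ _ _) (w≡w′ i) (e i)) ⟩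
          sum (λ i → (π ^[ weight (τ t′) i ]) (e i))     ≈⟨ eval-≈-sum t′ e ⟨
          eval G φ₀ φ₁ t′ e                              ∎

proposition4p7 : ∀ {c ℓ} (G : Group c ℓ) (φ₀ φ₁ π : Group.Carrier G → Group.Carrier G)
    (a b m : ℕ) .{{_ : NonZero m}} →
    IsAut G φ₀ → IsAut G φ₁ → IsPerm G π → HasOrder G π m →
    (∀ y → Group._≈_ G (φ₀ y) ((π ^[ a ]) y)) →
    (∀ y → Group._≈_ G (φ₁ y) ((π ^[ b ]) y)) →
    (∀ {n} (t t' : Br n) → Satisfies G φ₀ φ₁ t t' ⇔ ModEqTree a b m (τ t) (τ t'))
    × (∀ n k → HasClasses (Satisfies G φ₀ φ₁ {n}) k ⇔ HasClasses (ModEqTree a b m {n}) k)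
proposition4p7 G φ₀ φ₁ π a b m aut₀ aut₁ perm order φ₀≈π^a φ₁≈π^b =
    Satisfies⇔ModEqTree order
  , λ n → HasClasses-transport (Satisfies G φ₀ φ₁) (ModEqTree a b m) τ bracketing τ-bracketing
              (Satisfies⇔ModEqTree order)
  where open LinearQuasigroup G φ₀ φ₁ π a b aut₀ aut₁ perm φ₀≈π^a φ₁≈π^b
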